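{- Let $e_1,e_2$ be integers. For $\gamma=\begin{pmatrix}a&b\\c&d\end{pmatrix}\in\Gamma_0(4)$ put $t_1(\gamma)=c$, $t_2(\gamma)=a+(-1)^{e_1}c/4$, $t_3(\gamma)=d+(-1)^{e_2}c/4$, and $t_4(\gamma)=\frac14\left((-1)^{e_2}a+4b+(-1)^{e_1+e_2}c/4+(-1)^{e_1}d\right)$. Define $\Gamma_1=\{\gamma\in\Gamma_0(4): t_1(\gamma)=0\}$, $\Gamma_2=\{\gamma\in\Gamma_0(4): t_2(\gamma)=0\}$, $\Gamma_3=\{\gamma\in\Gamma_0(4): t_3(\gamma)=0,\ \text{and } b\neq0 \text{ if } (-1)^{e_1}=(-1)^{e_2}\}$, $\Gamma_4=\{\gamma\in\Gamma_0(4)\setminus\{\pm I\}: t_4(\gamma)=0\}$, $\Gamma_5=\Gamma_0(4)\setminus(\Gamma_1\cup\Gamma_2\cup\Gamma_3\cup\Gamma_4)$. Then $\Gamma_0(4)$ is the disjoint union $\Gamma_1\sqcup\Gamma_2\sqcup\Gamma_3\sqcup\Gamma_4\sqcup\Gamma_5$.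
   Context: $\Gamma_0(4)=\left\{\begin{pmatrix}a&b\\c&d\end{pmatrix}\in SL_2(\mathbb{Z}): c\equiv0\pmod 4\right\}$, and $I$ is the identity matrix. -}

module Defs where

open import Data.Nat using (ℕ)
open import Data.Integer as ℤ using (ℤ; +_; -1ℤ; 1ℤ; 0ℤ; ∣_∣; _^_)
open import Data.Integer.Divisibility using (_∣_)
open import Data.Rational as ℚ using (ℚ; _/_; 0ℚ)
open import Data.Fin using (Fin; zero; suc)
open import Data.Product using (_×_)
open import Data.Sum using (_⊎_)
open import Relation.Nullary using (¬_)
open import Relation.Binary.PropositionalEquality using (_≡_; _≢_)

record Mat : Set where
  constructor mat
  field
    a b c d : ℤ
open Mat public

I : Mat
I = mat 1ℤ 0ℤ 0ℤ 1ℤ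

-I : Mat
-I = mat -1ℤ 0ℤ 0ℤ -1ℤ

InΓ₀4 : Mat → Set
InΓ₀4 γ = (a γ ℤ.* d γ ℤ.- b γ ℤ.* c γ ≡ 1ℤ) × (+ 4 ∣ c γ)

sgn : ℤ → ℤ
sgn e = -1ℤ ^ ∣ e ∣

⟦_⟧ : ℤ → ℚ
⟦ x ⟧ = x / 1

t₁ t₂ t₃ t₄ : ℤ → ℤ → Mat → ℚ
t₁ e₁ e₂ γ = ⟦ c γ ⟧
t₂ e₁ e₂ γ = ⟦ a γ ⟧ ℚ.+ ⟦ sgn e₁ ⟧ ℚ.* (c γ / 4)
t₃ e₁ e₂ γ = ⟦ d γ ⟧ ℚ.+ ⟦ sgn e₂ ⟧ ℚ.* (c γ / 4)
t₄ e₁ e₂ γ = (1ℤ / 4) ℚ.* ( ⟦ sgn e₂ ℤ.* a γ ⟧ ℚ.+ ⟦ + 4 ℤ.* b γ ⟧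
                            ℚ.+ ⟦ sgn (e₁ ℤ.+ e₂) ⟧ ℚ.* (c γ / 4)
                            ℚ.+ ⟦ sgn e₁ ℤ.* d γ ⟧ )

Γ₁ Γ₂ Γ₃ Γ₄ Γ₅ : ℤ → ℤ → Mat → Set
Γ₁ e₁ e₂ γ = InΓ₀4 γ × t₁ e₁ e₂ γ ≡ 0ℚ
Γ₂ e₁ e₂ γ = InΓ₀4 γ × t₂ e₁ e₂ γ ≡ 0ℚ
Γ₃ e₁ e₂ γ = InΓ₀4 γ × t₃ e₁ e₂ γ ≡ 0ℚ × (sgn e₁ ≡ sgn e₂ → b γ ≢ 0ℤ)
Γ₄ e₁ e₂ γ = InΓ₀4 γ × ¬ (γ ≡ I ⊎ γ ≡ -I) × t₄ e₁ e₂ γ ≡ 0ℚ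
Γ₅ e₁ e₂ γ = InΓ₀4 γ × ¬ (Γ₁ e₁ e₂ γ ⊎ Γ₂ e₁ e₂ γ ⊎ Γ₃ e₁ e₂ γ ⊎ Γ₄ e₁ e₂ γ)

Γ : ℤ → ℤ → Fin 5 → Mat → Set
Γ e₁ e₂ zero = Γ₁ e₁ e₂
Γ e₁ e₂ (suc zero) = Γ₂ e₁ e₂
Γ e₁ e₂ (suc (suc zero)) = Γ₃ e₁ e₂
Γ e₁ e₂ (suc (suc (suc zero))) = Γ₄ e₁ e₂
Γ e₁ e₂ (suc (suc (suc (suc zero)))) = Γ₅ e₁ e₂

{-# OPTIONS --safe #-}

-- Write c = 4k, s₁ = (-1)^e₁ and s₂ = (-1)^e₂, so that t₂ = a + s₁k, t₃ = d + s₂k and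
-- 4t₄ = s₂a + 4b + s₁s₂k + s₁d. The identity  ad - bc = t₂t₃ - k·4t₄  shows that in SL₂(ℤ)
-- one of t₂, t₃ vanishing excludes one of t₁ = c, t₄ vanishing. Two pairs remain. If k = 0
-- then a = d = ±1 and t₄ = 0 reads 4b = -(s₁ + s₂)a, so b = 0 and γ = ±I. If t₂ = t₃ = 0 the
-- determinant becomes k(s₁s₂k - 4b) = 1, so k = ±1 and 4b = (s₁s₂ - 1)k, forcing s₁ = s₂ and
-- b = 0. Both times 4 ∤ 2 is what rules out the other signs. Since each Γᵢ is decidable and
-- Γ₅ is the complement of the others, the five sets cover Γ₀(4).
module Submission where

open import Defs
open import Data.Nat as ℕ using (zero; suc)
import Data.Nat.Properties as ℕ
import Data.Nat.Divisibility as ℕ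
open import Data.Integer as ℤ using (ℤ; +_; -[1+_]; 1ℤ; -1ℤ; 0ℤ; ∣_∣; _⊖_; _^_)
import Data.Integer.Properties as ℤ
open import Data.Integer.Divisibility.Signed using (divides; ∣ᵤ⇒∣)
open import Data.Integer.Tactic.RingSolver using (solve-∀)
open import Data.Rational as ℚ using (0ℚ; 1ℚ; _/_; toℚᵘ)
import Data.Rational.Properties as ℚ
import Data.Rational.Unnormalised as ℚᵘ
import Data.Rational.Unnormalised.Properties as ℚᵘ
open import Data.Fin using (Fin; zero; suc; #_)
open import Data.Product using (Σ; _×_; _,_; proj₁; uncurry)
open import Data.Sum as Sum using (_⊎_; inj₁; inj₂)
open import Data.Empty using (⊥-elim)
open import Relation.Nullary using (¬_; Dec; yes; no)
open import Relation.Nullary.Decidable using (map′; _×-dec_; _⊎-dec_; _→-dec_; ¬?)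
open import Relation.Binary.Definitions using (DecidableEquality)
open import Relation.Binary.PropositionalEquality

IsSign : ℤ → Set
IsSign s = s ≡ 1ℤ ⊎ s ≡ -1ℤ

-1^n-isSign : ∀ n → IsSign (-1ℤ ^ n)
-1^n-isSign zero = inj₁ refl
-1^n-isSign (suc n) with -1^n-isSign n
... | inj₁ eq = inj₂ (cong (-1ℤ ℤ.*_) eq)
... | inj₂ eq = inj₁ (cong (-1ℤ ℤ.*_) eq)

∣i∣≡1⇒isSign : ∀ {i} → ∣ i ∣ ≡ 1 → IsSign i
∣i∣≡1⇒isSign {+ _} refl = inj₁ refl
∣i∣≡1⇒isSign { -[1+ zero ]} refl = inj₂ refl

i*j≡1⇒i≡j : ∀ {i j} → i ℤ.* j ≡ 1ℤ → i ≡ j × IsSign i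
i*j≡1⇒i≡j {i} {j} ij≡1
  with ∣i∣≡1⇒isSign {i} (ℕ.m*n≡1⇒m≡1 ∣ i ∣ ∣ j ∣ ∣ij∣≡1)
     | ∣i∣≡1⇒isSign {j} (ℕ.m*n≡1⇒n≡1 ∣ i ∣ ∣ j ∣ ∣ij∣≡1)
  where ∣ij∣≡1 = trans (sym (ℤ.abs-* i j)) (cong ∣_∣ ij≡1)
... | inj₁ refl | inj₁ refl = refl , inj₁ refl
... | inj₂ refl | inj₂ refl = refl , inj₂ refl
i*j≡1⇒i≡j () | inj₁ refl | inj₂ refl
i*j≡1⇒i≡j () | inj₂ refl | inj₁ refl

^-∣⊖∣ : ∀ {x} → x ℤ.* x ≡ 1ℤ → ∀ m n → x ^ ∣ m ⊖ n ∣ ≡ x ^ m ℤ.* x ^ n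
^-∣⊖∣ {x} _ zero zero = refl
^-∣⊖∣ {x} _ zero (suc n) = sym (ℤ.*-identityˡ (x ^ suc n))
^-∣⊖∣ {x} _ (suc m) zero = sym (ℤ.*-identityʳ (x ^ suc m))
^-∣⊖∣ {x} x²≡1 (suc m) (suc n) = begin
  x ^ ∣ suc m ⊖ suc n ∣           ≡⟨ cong (λ i → x ^ ∣ i ∣) (ℤ.[1+m]⊖[1+n]≡m⊖n m n) ⟩
  x ^ ∣ m ⊖ n ∣                   ≡⟨ ^-∣⊖∣ x²≡1 m n ⟩
  x ^ m ℤ.* x ^ n                 ≡⟨ ℤ.*-identityˡ (x ^ m ℤ.* x ^ n) ⟨
  1ℤ ℤ.* (x ^ m ℤ.* x ^ n)        ≡⟨ cong (ℤ._* (x ^ m ℤ.* x ^ n)) x²≡1 ⟨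
  x ℤ.* x ℤ.* (x ^ m ℤ.* x ^ n)   ≡⟨ interchange x (x ^ m) (x ^ n) ⟩
  x ^ suc m ℤ.* x ^ suc n         ∎
  where
  open ≡-Reasoning
  interchange : ∀ x y z → x ℤ.* x ℤ.* (y ℤ.* z) ≡ x ℤ.* y ℤ.* (x ℤ.* z)
  interchange = solve-∀

sgn-+ : ∀ e₁ e₂ → sgn (e₁ ℤ.+ e₂) ≡ sgn e₁ ℤ.* sgn e₂
sgn-+ (+ m) (+ n) = ℤ.^-distribˡ-+-* -1ℤ m n
sgn-+ (+ m) -[1+ n ] = ^-∣⊖∣ refl m (suc n)
sgn-+ -[1+ m ] (+ n) = trans (^-∣⊖∣ refl n (suc m)) (ℤ.*-comm (sgn (+ n)) (sgn -[1+ m ]))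
sgn-+ -[1+ m ] -[1+ n ] = begin
  -1ℤ ^ suc (suc (m ℕ.+ n))   ≡⟨ cong (λ i → -1ℤ ^ suc i) (ℕ.+-suc m n) ⟨
  -1ℤ ^ (suc m ℕ.+ suc n)     ≡⟨ ℤ.^-distribˡ-+-* -1ℤ (suc m) (suc n) ⟩
  sgn -[1+ m ] ℤ.* sgn -[1+ n ] ∎
  where open ≡-Reasoning

i*4≢2 : ∀ i → i ℤ.* + 4 ≢ + 2
i*4≢2 (+ 0) ()
i*4≢2 (+ suc n) ()

i*4≢-2 : ∀ i → i ℤ.* + 4 ≢ -[1+ 1 ]
i*4≢-2 (+ 0) ()
i*4≢-2 -[1+ n ] ()

i*4≡0⇒i≡0 : ∀ i → i ℤ.* + 4 ≡ 0ℤ → i ≡ 0ℤ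
i*4≡0⇒i≡0 (+ 0) _ = refl

b*4≡-[s₁+s₂]a⇒b≡0 : ∀ {s₁ s₂ a b} → IsSign s₁ → IsSign s₂ → IsSign a →
                    b ℤ.* + 4 ≡ ℤ.- ((s₁ ℤ.+ s₂) ℤ.* a) → b ≡ 0ℤ
b*4≡-[s₁+s₂]a⇒b≡0 {b = b} (inj₁ refl) (inj₁ refl) (inj₁ refl) eq = ⊥-elim (i*4≢-2 b eq)
b*4≡-[s₁+s₂]a⇒b≡0 {b = b} (inj₁ refl) (inj₁ refl) (inj₂ refl) eq = ⊥-elim (i*4≢2 b eq)
b*4≡-[s₁+s₂]a⇒b≡0 {b = b} (inj₁ refl) (inj₂ refl) _          eq = i*4≡0⇒i≡0 b eq
b*4≡-[s₁+s₂]a⇒b≡0 {b = b} (inj₂ refl) (inj₁ refl) _          eq = i*4≡0⇒i≡0 b eq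
b*4≡-[s₁+s₂]a⇒b≡0 {b = b} (inj₂ refl) (inj₂ refl) (inj₁ refl) eq = ⊥-elim (i*4≢2 b eq)
b*4≡-[s₁+s₂]a⇒b≡0 {b = b} (inj₂ refl) (inj₂ refl) (inj₂ refl) eq = ⊥-elim (i*4≢-2 b eq)

b*4≡s₁s₂k-k⇒s₁≡s₂∧b≡0 : ∀ {s₁ s₂ k b} → IsSign s₁ → IsSign s₂ → IsSign k →
                        b ℤ.* + 4 ≡ s₁ ℤ.* s₂ ℤ.* k ℤ.- k → s₁ ≡ s₂ × b ≡ 0ℤ
b*4≡s₁s₂k-k⇒s₁≡s₂∧b≡0 {b = b} (inj₁ refl) (inj₁ refl) (inj₁ refl) eq = refl , i*4≡0⇒i≡0 b eq
b*4≡s₁s₂k-k⇒s₁≡s₂∧b≡0 {b = b} (inj₁ refl) (inj₁ refl) (inj₂ refl) eq = refl , i*4≡0⇒i≡0 b eq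
b*4≡s₁s₂k-k⇒s₁≡s₂∧b≡0 {b = b} (inj₂ refl) (inj₂ refl) (inj₁ refl) eq = refl , i*4≡0⇒i≡0 b eq
b*4≡s₁s₂k-k⇒s₁≡s₂∧b≡0 {b = b} (inj₂ refl) (inj₂ refl) (inj₂ refl) eq = refl , i*4≡0⇒i≡0 b eq
b*4≡s₁s₂k-k⇒s₁≡s₂∧b≡0 {b = b} (inj₁ refl) (inj₂ refl) (inj₁ refl) eq = ⊥-elim (i*4≢-2 b eq)
b*4≡s₁s₂k-k⇒s₁≡s₂∧b≡0 {b = b} (inj₁ refl) (inj₂ refl) (inj₂ refl) eq = ⊥-elim (i*4≢2 b eq)
b*4≡s₁s₂k-k⇒s₁≡s₂∧b≡0 {b = b} (inj₂ refl) (inj₁ refl) (inj₁ refl) eq = ⊥-elim (i*4≢-2 b eq)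
b*4≡s₁s₂k-k⇒s₁≡s₂∧b≡0 {b = b} (inj₂ refl) (inj₁ refl) (inj₂ refl) eq = ⊥-elim (i*4≢2 b eq)

-- With c = 4k, s₁ = (-1)^e₁ and s₂ = (-1)^e₂ these are t₂, t₃ and 4 t₄.
T₂ : (s₁ a k : ℤ) → ℤ
T₂ s₁ a k = a ℤ.+ s₁ ℤ.* k

T₃ : (s₂ d k : ℤ) → ℤ
T₃ s₂ d k = d ℤ.+ s₂ ℤ.* k

T₄ : (s₁ s₂ a b k d : ℤ) → ℤ
T₄ s₁ s₂ a b k d = s₂ ℤ.* a ℤ.+ + 4 ℤ.* b ℤ.+ s₁ ℤ.* s₂ ℤ.* k ℤ.+ s₁ ℤ.* d

det : (a b k d : ℤ) → ℤ
det a b k d = a ℤ.* d ℤ.- b ℤ.* (k ℤ.* + 4)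

det≡T₂T₃-kT₄ : ∀ s₁ s₂ a b k d → det a b k d ≡ T₂ s₁ a k ℤ.* T₃ s₂ d k ℤ.- k ℤ.* T₄ s₁ s₂ a b k d
det≡T₂T₃-kT₄ = identity
  where
  identity : ∀ s₁ s₂ a b k d → a ℤ.* d ℤ.- b ℤ.* (k ℤ.* + 4)
           ≡ (a ℤ.+ s₁ ℤ.* k) ℤ.* (d ℤ.+ s₂ ℤ.* k)
             ℤ.- k ℤ.* (s₂ ℤ.* a ℤ.+ + 4 ℤ.* b ℤ.+ s₁ ℤ.* s₂ ℤ.* k ℤ.+ s₁ ℤ.* d)
  identity = solve-∀

x*y≡0 : ∀ {x y} → x ≡ 0ℤ ⊎ y ≡ 0ℤ → x ℤ.* y ≡ 0ℤ
x*y≡0 {y = y} (inj₁ refl) = refl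
x*y≡0 {x = x} (inj₂ refl) = ℤ.*-zeroʳ x

det≡0 : ∀ s₁ s₂ a b k d → T₂ s₁ a k ≡ 0ℤ ⊎ T₃ s₂ d k ≡ 0ℤ → k ≡ 0ℤ ⊎ T₄ s₁ s₂ a b k d ≡ 0ℤ →
        det a b k d ≡ 0ℤ
det≡0 s₁ s₂ a b k d T₂T₃≡0 kT₄≡0 = begin
  det a b k d                                        ≡⟨ det≡T₂T₃-kT₄ s₁ s₂ a b k d ⟩
  T₂ s₁ a k ℤ.* T₃ s₂ d k ℤ.- k ℤ.* T₄ s₁ s₂ a b k d ≡⟨ cong₂ ℤ._-_ (x*y≡0 T₂T₃≡0) (x*y≡0 kT₄≡0) ⟩
  0ℤ                                                 ∎
  where open ≡-Reasoning

k≡0∧T₄≡0⇒a≡d∧b≡0 : ∀ {s₁ s₂} a b d → IsSign s₁ → IsSign s₂ → det a b 0ℤ d ≡ 1ℤ →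
                   T₄ s₁ s₂ a b 0ℤ d ≡ 0ℤ → a ≡ d × IsSign a × b ≡ 0ℤ
k≡0∧T₄≡0⇒a≡d∧b≡0 {s₁} {s₂} a b d ±s₁ ±s₂ det≡1 T₄≡0
  with i*j≡1⇒i≡j {a} {d} (trans (sym (det-at-k≡0 a b d)) det≡1)
  where
  det-at-k≡0 : ∀ a b d → a ℤ.* d ℤ.- b ℤ.* (0ℤ ℤ.* + 4) ≡ a ℤ.* d
  det-at-k≡0 = solve-∀
... | refl , ±a = refl , ±a , b*4≡-[s₁+s₂]a⇒b≡0 ±s₁ ±s₂ ±a (begin
  b ℤ.* + 4                                      ≡⟨ identity s₁ s₂ a b ⟩
  T₄ s₁ s₂ a b 0ℤ a ℤ.- (s₁ ℤ.+ s₂) ℤ.* a        ≡⟨ cong (ℤ._- (s₁ ℤ.+ s₂) ℤ.* a) T₄≡0 ⟩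
  0ℤ ℤ.- (s₁ ℤ.+ s₂) ℤ.* a                       ≡⟨ ℤ.+-identityˡ _ ⟩
  ℤ.- ((s₁ ℤ.+ s₂) ℤ.* a)                        ∎)
  where
  open ≡-Reasoning
  identity : ∀ s₁ s₂ a b → b ℤ.* + 4
           ≡ (s₂ ℤ.* a ℤ.+ + 4 ℤ.* b ℤ.+ s₁ ℤ.* s₂ ℤ.* 0ℤ ℤ.+ s₁ ℤ.* a) ℤ.- (s₁ ℤ.+ s₂) ℤ.* a
  identity = solve-∀

T₂≡0∧T₃≡0⇒det≡k[s₁s₂k-4b] : ∀ s₁ s₂ a b k d → T₂ s₁ a k ≡ 0ℤ → T₃ s₂ d k ≡ 0ℤ →
                              det a b k d ≡ k ℤ.* (s₁ ℤ.* s₂ ℤ.* k ℤ.- b ℤ.* + 4)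
T₂≡0∧T₃≡0⇒det≡k[s₁s₂k-4b] s₁ s₂ a b k d T₂≡0 T₃≡0 = begin
  det a b k d                                             ≡⟨ identity s₁ s₂ a b k d ⟩
  T₂ s₁ a k ℤ.* d ℤ.- s₁ ℤ.* k ℤ.* T₃ s₂ d k ℤ.+ k ℤ.* X
    ≡⟨ cong₂ (λ u v → u ℤ.* d ℤ.- s₁ ℤ.* k ℤ.* v ℤ.+ k ℤ.* X) T₂≡0 T₃≡0 ⟩
  0ℤ ℤ.* d ℤ.- s₁ ℤ.* k ℤ.* 0ℤ ℤ.+ k ℤ.* X               ≡⟨ cancel d (s₁ ℤ.* k) (k ℤ.* X) ⟩
  k ℤ.* X                                                 ∎
  where
  open ≡-Reasoning
  X = s₁ ℤ.* s₂ ℤ.* k ℤ.- b ℤ.* + 4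
  identity : ∀ s₁ s₂ a b k d → a ℤ.* d ℤ.- b ℤ.* (k ℤ.* + 4)
           ≡ (a ℤ.+ s₁ ℤ.* k) ℤ.* d ℤ.- s₁ ℤ.* k ℤ.* (d ℤ.+ s₂ ℤ.* k)
             ℤ.+ k ℤ.* (s₁ ℤ.* s₂ ℤ.* k ℤ.- b ℤ.* + 4)
  identity = solve-∀
  cancel : ∀ x y z → 0ℤ ℤ.* x ℤ.- y ℤ.* 0ℤ ℤ.+ z ≡ z
  cancel = solve-∀

T₂≡0∧T₃≡0⇒s₁≡s₂∧b≡0 : ∀ {s₁ s₂} a b k d → IsSign s₁ → IsSign s₂ → det a b k d ≡ 1ℤ →
                      T₂ s₁ a k ≡ 0ℤ → T₃ s₂ d k ≡ 0ℤ → s₁ ≡ s₂ × b ≡ 0ℤ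
T₂≡0∧T₃≡0⇒s₁≡s₂∧b≡0 {s₁} {s₂} a b k d ±s₁ ±s₂ det≡1 T₂≡0 T₃≡0
  with i*j≡1⇒i≡j (trans (sym (T₂≡0∧T₃≡0⇒det≡k[s₁s₂k-4b] s₁ s₂ a b k d T₂≡0 T₃≡0)) det≡1)
... | k≡s₁s₂k-4b , ±k = b*4≡s₁s₂k-k⇒s₁≡s₂∧b≡0 ±s₁ ±s₂ ±k (begin
  b ℤ.* + 4                                     ≡⟨ solve-for-b s₁ s₂ b k ⟩
  s₁ ℤ.* s₂ ℤ.* k ℤ.- (s₁ ℤ.* s₂ ℤ.* k ℤ.- b ℤ.* + 4) ≡⟨ cong (λ x → s₁ ℤ.* s₂ ℤ.* k ℤ.- x) k≡s₁s₂k-4b ⟨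
  s₁ ℤ.* s₂ ℤ.* k ℤ.- k                         ∎)
  where
  open ≡-Reasoning
  solve-for-b : ∀ s₁ s₂ b k → b ℤ.* + 4 ≡ s₁ ℤ.* s₂ ℤ.* k ℤ.- (s₁ ℤ.* s₂ ℤ.* k ℤ.- b ℤ.* + 4)
  solve-for-b = solve-∀

toℚᵘ-⟦⟧ : ∀ x → toℚᵘ ⟦ x ⟧ ℚᵘ.≃ ℚᵘ.mkℚᵘ x 0
toℚᵘ-⟦⟧ x = ℚ.toℚᵘ-fromℚᵘ (ℚᵘ.mkℚᵘ x 0)

⟦⟧-injective : ∀ {x y} → ⟦ x ⟧ ≡ ⟦ y ⟧ → x ≡ y
⟦⟧-injective {x} {y} eq with ℚ./-injective-≃ (ℚᵘ.mkℚᵘ x 0) (ℚᵘ.mkℚᵘ y 0) eq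
... | ℚᵘ.*≡* x*1≡y*1 = ℤ.*-cancelʳ-≡ x y 1ℤ x*1≡y*1

⟦⟧-+ : ∀ x y → ⟦ x ℤ.+ y ⟧ ≡ ⟦ x ⟧ ℚ.+ ⟦ y ⟧
⟦⟧-+ x y = ℚ.toℚᵘ-injective (begin
  toℚᵘ ⟦ x ℤ.+ y ⟧                         ≈⟨ toℚᵘ-⟦⟧ (x ℤ.+ y) ⟩
  ℚᵘ.mkℚᵘ (x ℤ.+ y) 0                      ≈⟨ ℚᵘ.≃-reflexive (cong (λ z → ℚᵘ.mkℚᵘ z 0) x+y≡x*1+y*1) ⟩
  ℚᵘ.mkℚᵘ x 0 ℚᵘ.+ ℚᵘ.mkℚᵘ y 0             ≈⟨ ℚᵘ.+-cong (toℚᵘ-⟦⟧ x) (toℚᵘ-⟦⟧ y) ⟨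
  toℚᵘ ⟦ x ⟧ ℚᵘ.+ toℚᵘ ⟦ y ⟧               ≈⟨ ℚ.toℚᵘ-homo-+ ⟦ x ⟧ ⟦ y ⟧ ⟨
  toℚᵘ (⟦ x ⟧ ℚ.+ ⟦ y ⟧)                   ∎)
  where
  open ℚᵘ.≃-Reasoning
  x+y≡x*1+y*1 : x ℤ.+ y ≡ x ℤ.* 1ℤ ℤ.+ y ℤ.* 1ℤ
  x+y≡x*1+y*1 = sym (cong₂ ℤ._+_ (ℤ.*-identityʳ x) (ℤ.*-identityʳ y))

⟦⟧-* : ∀ x y → ⟦ x ℤ.* y ⟧ ≡ ⟦ x ⟧ ℚ.* ⟦ y ⟧
⟦⟧-* x y = ℚ.toℚᵘ-injective (begin
  toℚᵘ ⟦ x ℤ.* y ⟧                         ≈⟨ toℚᵘ-⟦⟧ (x ℤ.* y) ⟩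
  ℚᵘ.mkℚᵘ x 0 ℚᵘ.* ℚᵘ.mkℚᵘ y 0             ≈⟨ ℚᵘ.*-cong (toℚᵘ-⟦⟧ x) (toℚᵘ-⟦⟧ y) ⟨
  toℚᵘ ⟦ x ⟧ ℚᵘ.* toℚᵘ ⟦ y ⟧               ≈⟨ ℚ.toℚᵘ-homo-* ⟦ x ⟧ ⟦ y ⟧ ⟨
  toℚᵘ (⟦ x ⟧ ℚ.* ⟦ y ⟧)                   ∎)
  where open ℚᵘ.≃-Reasoning

i*n/n≡⟦i⟧ : ∀ i n .{{_ : ℕ.NonZero n}} → (i ℤ.* + n) / n ≡ ⟦ i ⟧
i*n/n≡⟦i⟧ i n@(suc m) = ℚ.toℚᵘ-injective (begin
  toℚᵘ ((i ℤ.* + n) / n)     ≈⟨ ℚ.toℚᵘ-fromℚᵘ (ℚᵘ.mkℚᵘ (i ℤ.* + n) m) ⟩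
  ℚᵘ.mkℚᵘ (i ℤ.* + n) m      ≈⟨ ℚᵘ.*≡* (ℤ.*-identityʳ (i ℤ.* + n)) ⟩
  ℚᵘ.mkℚᵘ i 0                ≈⟨ toℚᵘ-⟦⟧ i ⟨
  toℚᵘ ⟦ i ⟧                 ∎)
  where open ℚᵘ.≃-Reasoning

p*q≡0⇒q≡0 : ∀ p q .{{_ : ℚ.NonZero p}} → p ℚ.* q ≡ 0ℚ → q ≡ 0ℚ
p*q≡0⇒q≡0 p q pq≡0 = begin
  q                        ≡⟨ ℚ.*-identityˡ q ⟨
  1ℚ ℚ.* q                 ≡⟨ cong (ℚ._* q) (ℚ.*-inverseˡ p) ⟨
  ℚ.1/ p ℚ.* p ℚ.* q       ≡⟨ ℚ.*-assoc (ℚ.1/ p) p q ⟩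
  ℚ.1/ p ℚ.* (p ℚ.* q)     ≡⟨ cong (ℚ.1/ p ℚ.*_) pq≡0 ⟩
  ℚ.1/ p ℚ.* 0ℚ            ≡⟨ ℚ.*-zeroʳ (ℚ.1/ p) ⟩
  0ℚ                       ∎
  where open ≡-Reasoning

⟦x⟧+⟦s⟧*[k*4/4]≡⟦x+sk⟧ : ∀ x s k → ⟦ x ⟧ ℚ.+ ⟦ s ⟧ ℚ.* ((k ℤ.* + 4) / 4) ≡ ⟦ x ℤ.+ s ℤ.* k ⟧
⟦x⟧+⟦s⟧*[k*4/4]≡⟦x+sk⟧ x s k = begin
  ⟦ x ⟧ ℚ.+ ⟦ s ⟧ ℚ.* ((k ℤ.* + 4) / 4)   ≡⟨ cong (λ q → ⟦ x ⟧ ℚ.+ ⟦ s ⟧ ℚ.* q) (i*n/n≡⟦i⟧ k 4) ⟩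
  ⟦ x ⟧ ℚ.+ ⟦ s ⟧ ℚ.* ⟦ k ⟧               ≡⟨ cong (⟦ x ⟧ ℚ.+_) (⟦⟧-* s k) ⟨
  ⟦ x ⟧ ℚ.+ ⟦ s ℤ.* k ⟧                   ≡⟨ ⟦⟧-+ x (s ℤ.* k) ⟨
  ⟦ x ℤ.+ s ℤ.* k ⟧                       ∎
  where open ≡-Reasoning

module _ (e₁ e₂ a b k d : ℤ) where

  t₁≡0⇒k≡0 : t₁ e₁ e₂ (mat a b (k ℤ.* + 4) d) ≡ 0ℚ → k ≡ 0ℤ
  t₁≡0⇒k≡0 t₁≡0 = i*4≡0⇒i≡0 k (⟦⟧-injective t₁≡0)

  t₂≡0⇒T₂≡0 : t₂ e₁ e₂ (mat a b (k ℤ.* + 4) d) ≡ 0ℚ → T₂ (sgn e₁) a k ≡ 0ℤ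
  t₂≡0⇒T₂≡0 t₂≡0 = ⟦⟧-injective (trans (sym (⟦x⟧+⟦s⟧*[k*4/4]≡⟦x+sk⟧ a (sgn e₁) k)) t₂≡0)

  t₃≡0⇒T₃≡0 : t₃ e₁ e₂ (mat a b (k ℤ.* + 4) d) ≡ 0ℚ → T₃ (sgn e₂) d k ≡ 0ℤ
  t₃≡0⇒T₃≡0 t₃≡0 = ⟦⟧-injective (trans (sym (⟦x⟧+⟦s⟧*[k*4/4]≡⟦x+sk⟧ d (sgn e₂) k)) t₃≡0)

  t₄≡0⇒T₄≡0 : t₄ e₁ e₂ (mat a b (k ℤ.* + 4) d) ≡ 0ℚ → T₄ (sgn e₁) (sgn e₂) a b k d ≡ 0ℤ
  t₄≡0⇒T₄≡0 t₄≡0 = ⟦⟧-injective (begin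
    ⟦ T₄ s₁ s₂ a b k d ⟧                           ≡⟨ cong (λ s → ⟦ u ℤ.+ s ℤ.* k ℤ.+ s₁ ℤ.* d ⟧) (sgn-+ e₁ e₂) ⟨
    ⟦ u ℤ.+ s₁₂ ℤ.* k ℤ.+ s₁ ℤ.* d ⟧               ≡⟨ ⟦⟧-+ (u ℤ.+ s₁₂ ℤ.* k) (s₁ ℤ.* d) ⟩
    ⟦ u ℤ.+ s₁₂ ℤ.* k ⟧ ℚ.+ ⟦ s₁ ℤ.* d ⟧           ≡⟨ cong (ℚ._+ ⟦ s₁ ℤ.* d ⟧) (⟦x⟧+⟦s⟧*[k*4/4]≡⟦x+sk⟧ u s₁₂ k) ⟨
    ⟦ u ⟧ ℚ.+ ⟦ s₁₂ ⟧ ℚ.* c/4 ℚ.+ ⟦ s₁ ℤ.* d ⟧     ≡⟨ cong (λ q → q ℚ.+ ⟦ s₁₂ ⟧ ℚ.* c/4 ℚ.+ ⟦ s₁ ℤ.* d ⟧)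
                                                         (⟦⟧-+ (s₂ ℤ.* a) (+ 4 ℤ.* b)) ⟩
    ⟦ s₂ ℤ.* a ⟧ ℚ.+ ⟦ + 4 ℤ.* b ⟧ ℚ.+ ⟦ s₁₂ ⟧ ℚ.* c/4 ℚ.+ ⟦ s₁ ℤ.* d ⟧
                                                   ≡⟨ p*q≡0⇒q≡0 (1ℤ / 4) _ t₄≡0 ⟩
    0ℚ                                             ∎)
    where
    open ≡-Reasoning
    s₁ = sgn e₁
    s₂ = sgn e₂
    s₁₂ = sgn (e₁ ℤ.+ e₂)
    u = s₂ ℤ.* a ℤ.+ + 4 ℤ.* b
    c/4 = (k ℤ.* + 4) / 4

data Γ₀4-Entries : Mat → Set where
  entries : ∀ a b k d → det a b k d ≡ 1ℤ → Γ₀4-Entries (mat a b (k ℤ.* + 4) d)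

Γ₀4-entries : ∀ γ → InΓ₀4 γ → Γ₀4-Entries γ
Γ₀4-entries (mat a b c d) (det≡1 , 4∣c) with ∣ᵤ⇒∣ {+ 4} {c} 4∣c
... | divides k refl = entries a b k d det≡1

_≟ᴹ_ : DecidableEquality Mat
mat a b c d ≟ᴹ mat a′ b′ c′ d′ =
  map′ (λ { (refl , refl , refl , refl) → refl }) (λ { refl → refl , refl , refl , refl })
       (a ℤ.≟ a′ ×-dec b ℤ.≟ b′ ×-dec c ℤ.≟ c′ ×-dec d ℤ.≟ d′)

-- Unsigned divisibility on ℤ is divisibility of the absolute values in ℕ.
InΓ₀4? : ∀ γ → Dec (InΓ₀4 γ)
InΓ₀4? γ = (a γ ℤ.* d γ ℤ.- b γ ℤ.* c γ ℤ.≟ 1ℤ) ×-dec (4 ℕ.∣? ∣ c γ ∣)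

module _ (e₁ e₂ : ℤ) where

  private
    ±s₁ : IsSign (sgn e₁)
    ±s₁ = -1^n-isSign ∣ e₁ ∣
    ±s₂ : IsSign (sgn e₂)
    ±s₂ = -1^n-isSign ∣ e₂ ∣

  t₂∨t₃≡0⇒t₁∧t₄≢0 : ∀ γ → InΓ₀4 γ → t₂ e₁ e₂ γ ≡ 0ℚ ⊎ t₃ e₁ e₂ γ ≡ 0ℚ →
                    ¬ (t₁ e₁ e₂ γ ≡ 0ℚ ⊎ t₄ e₁ e₂ γ ≡ 0ℚ)
  t₂∨t₃≡0⇒t₁∧t₄≢0 γ γ∈Γ₀4 t₂t₃≡0 t₁t₄≡0 with Γ₀4-entries γ γ∈Γ₀4
  ... | entries a b k d det≡1 = 1≢0 (trans (sym det≡1) (det≡0 (sgn e₁) (sgn e₂) a b k d T₂T₃≡0 kT₄≡0))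
    where
    1≢0 : 1ℤ ≢ 0ℤ
    1≢0 ()
    T₂T₃≡0 = Sum.map (t₂≡0⇒T₂≡0 e₁ e₂ a b k d) (t₃≡0⇒T₃≡0 e₁ e₂ a b k d) t₂t₃≡0
    kT₄≡0 = Sum.map (t₁≡0⇒k≡0 e₁ e₂ a b k d) (t₄≡0⇒T₄≡0 e₁ e₂ a b k d) t₁t₄≡0

  Γ₁∩Γ₂≡∅ : ∀ γ → Γ₁ e₁ e₂ γ → ¬ Γ₂ e₁ e₂ γ
  Γ₁∩Γ₂≡∅ γ (γ∈Γ₀4 , t₁≡0) (_ , t₂≡0) = t₂∨t₃≡0⇒t₁∧t₄≢0 γ γ∈Γ₀4 (inj₁ t₂≡0) (inj₁ t₁≡0)

  Γ₁∩Γ₃≡∅ : ∀ γ → Γ₁ e₁ e₂ γ → ¬ Γ₃ e₁ e₂ γ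
  Γ₁∩Γ₃≡∅ γ (γ∈Γ₀4 , t₁≡0) (_ , t₃≡0 , _) = t₂∨t₃≡0⇒t₁∧t₄≢0 γ γ∈Γ₀4 (inj₂ t₃≡0) (inj₁ t₁≡0)

  Γ₂∩Γ₄≡∅ : ∀ γ → Γ₂ e₁ e₂ γ → ¬ Γ₄ e₁ e₂ γ
  Γ₂∩Γ₄≡∅ γ (γ∈Γ₀4 , t₂≡0) (_ , _ , t₄≡0) = t₂∨t₃≡0⇒t₁∧t₄≢0 γ γ∈Γ₀4 (inj₁ t₂≡0) (inj₂ t₄≡0)

  Γ₃∩Γ₄≡∅ : ∀ γ → Γ₃ e₁ e₂ γ → ¬ Γ₄ e₁ e₂ γ
  Γ₃∩Γ₄≡∅ γ (γ∈Γ₀4 , t₃≡0 , _) (_ , _ , t₄≡0) = t₂∨t₃≡0⇒t₁∧t₄≢0 γ γ∈Γ₀4 (inj₂ t₃≡0) (inj₂ t₄≡0)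

  Γ₁∩Γ₄≡∅ : ∀ γ → Γ₁ e₁ e₂ γ → ¬ Γ₄ e₁ e₂ γ
  Γ₁∩Γ₄≡∅ γ (γ∈Γ₀4 , t₁≡0) (_ , γ≢±I , t₄≡0) with Γ₀4-entries γ γ∈Γ₀4
  ... | entries a b k d det≡1 with t₁≡0⇒k≡0 e₁ e₂ a b k d t₁≡0
  ... | refl with k≡0∧T₄≡0⇒a≡d∧b≡0 a b d ±s₁ ±s₂ det≡1 (t₄≡0⇒T₄≡0 e₁ e₂ a b 0ℤ d t₄≡0)
  ... | refl , inj₁ refl , refl = γ≢±I (inj₁ refl)
  ... | refl , inj₂ refl , refl = γ≢±I (inj₂ refl)

  Γ₂∩Γ₃≡∅ : ∀ γ → Γ₂ e₁ e₂ γ → ¬ Γ₃ e₁ e₂ γ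
  Γ₂∩Γ₃≡∅ γ (γ∈Γ₀4 , t₂≡0) (_ , t₃≡0 , s₁≡s₂⇒b≢0) with Γ₀4-entries γ γ∈Γ₀4
  ... | entries a b k d det≡1 = uncurry s₁≡s₂⇒b≢0
          (T₂≡0∧T₃≡0⇒s₁≡s₂∧b≡0 a b k d ±s₁ ±s₂ det≡1
             (t₂≡0⇒T₂≡0 e₁ e₂ a b k d t₂≡0) (t₃≡0⇒T₃≡0 e₁ e₂ a b k d t₃≡0))

  Γ-index-unique : ∀ γ i j → Γ e₁ e₂ i γ → Γ e₁ e₂ j γ → i ≡ j
  Γ-index-unique γ zero zero _ _ = refl
  Γ-index-unique γ zero (suc zero) x y = ⊥-elim (Γ₁∩Γ₂≡∅ γ x y)
  Γ-index-unique γ zero (suc (suc zero)) x y = ⊥-elim (Γ₁∩Γ₃≡∅ γ x y)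
  Γ-index-unique γ zero (suc (suc (suc zero))) x y = ⊥-elim (Γ₁∩Γ₄≡∅ γ x y)
  Γ-index-unique γ zero (suc (suc (suc (suc zero)))) x (_ , ∉) = ⊥-elim (∉ (inj₁ x))
  Γ-index-unique γ (suc zero) zero x y = ⊥-elim (Γ₁∩Γ₂≡∅ γ y x)
  Γ-index-unique γ (suc zero) (suc zero) _ _ = refl
  Γ-index-unique γ (suc zero) (suc (suc zero)) x y = ⊥-elim (Γ₂∩Γ₃≡∅ γ x y)
  Γ-index-unique γ (suc zero) (suc (suc (suc zero))) x y = ⊥-elim (Γ₂∩Γ₄≡∅ γ x y)
  Γ-index-unique γ (suc zero) (suc (suc (suc (suc zero)))) x (_ , ∉) = ⊥-elim (∉ (inj₂ (inj₁ x)))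
  Γ-index-unique γ (suc (suc zero)) zero x y = ⊥-elim (Γ₁∩Γ₃≡∅ γ y x)
  Γ-index-unique γ (suc (suc zero)) (suc zero) x y = ⊥-elim (Γ₂∩Γ₃≡∅ γ y x)
  Γ-index-unique γ (suc (suc zero)) (suc (suc zero)) _ _ = refl
  Γ-index-unique γ (suc (suc zero)) (suc (suc (suc zero))) x y = ⊥-elim (Γ₃∩Γ₄≡∅ γ x y)
  Γ-index-unique γ (suc (suc zero)) (suc (suc (suc (suc zero)))) x (_ , ∉) = ⊥-elim (∉ (inj₂ (inj₂ (inj₁ x))))
  Γ-index-unique γ (suc (suc (suc zero))) zero x y = ⊥-elim (Γ₁∩Γ₄≡∅ γ y x)
  Γ-index-unique γ (suc (suc (suc zero))) (suc zero) x y = ⊥-elim (Γ₂∩Γ₄≡∅ γ y x)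
  Γ-index-unique γ (suc (suc (suc zero))) (suc (suc zero)) x y = ⊥-elim (Γ₃∩Γ₄≡∅ γ y x)
  Γ-index-unique γ (suc (suc (suc zero))) (suc (suc (suc zero))) _ _ = refl
  Γ-index-unique γ (suc (suc (suc zero))) (suc (suc (suc (suc zero)))) x (_ , ∉) = ⊥-elim (∉ (inj₂ (inj₂ (inj₂ x))))
  Γ-index-unique γ (suc (suc (suc (suc zero)))) zero (_ , ∉) y = ⊥-elim (∉ (inj₁ y))
  Γ-index-unique γ (suc (suc (suc (suc zero)))) (suc zero) (_ , ∉) y = ⊥-elim (∉ (inj₂ (inj₁ y)))
  Γ-index-unique γ (suc (suc (suc (suc zero)))) (suc (suc zero)) (_ , ∉) y = ⊥-elim (∉ (inj₂ (inj₂ (inj₁ y))))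
  Γ-index-unique γ (suc (suc (suc (suc zero)))) (suc (suc (suc zero))) (_ , ∉) y = ⊥-elim (∉ (inj₂ (inj₂ (inj₂ y))))
  Γ-index-unique γ (suc (suc (suc (suc zero)))) (suc (suc (suc (suc zero)))) _ _ = refl

  Γ₁? : ∀ γ → Dec (Γ₁ e₁ e₂ γ)
  Γ₁? γ = InΓ₀4? γ ×-dec t₁ e₁ e₂ γ ℚ.≟ 0ℚ

  Γ₂? : ∀ γ → Dec (Γ₂ e₁ e₂ γ)
  Γ₂? γ = InΓ₀4? γ ×-dec t₂ e₁ e₂ γ ℚ.≟ 0ℚ

  Γ₃? : ∀ γ → Dec (Γ₃ e₁ e₂ γ)
  Γ₃? γ = InΓ₀4? γ ×-dec t₃ e₁ e₂ γ ℚ.≟ 0ℚ ×-dec (sgn e₁ ℤ.≟ sgn e₂ →-dec ¬? (b γ ℤ.≟ 0ℤ))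

  Γ₄? : ∀ γ → Dec (Γ₄ e₁ e₂ γ)
  Γ₄? γ = InΓ₀4? γ ×-dec ¬? (γ ≟ᴹ I ⊎-dec γ ≟ᴹ -I) ×-dec t₄ e₁ e₂ γ ℚ.≟ 0ℚ

  Γ-cover : ∀ γ → InΓ₀4 γ → Σ (Fin 5) (λ i → Γ e₁ e₂ i γ)
  Γ-cover γ γ∈Γ₀4 with Γ₁? γ ⊎-dec Γ₂? γ ⊎-dec Γ₃? γ ⊎-dec Γ₄? γ
  ... | yes (inj₁ γ∈Γ₁)                 = # 0 , γ∈Γ₁
  ... | yes (inj₂ (inj₁ γ∈Γ₂))          = # 1 , γ∈Γ₂
  ... | yes (inj₂ (inj₂ (inj₁ γ∈Γ₃)))   = # 2 , γ∈Γ₃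
  ... | yes (inj₂ (inj₂ (inj₂ γ∈Γ₄)))   = # 3 , γ∈Γ₄
  ... | no γ∉Γ₁₂₃₄                      = # 4 , γ∈Γ₀4 , γ∉Γ₁₂₃₄

  Γ⊆Γ₀4 : ∀ γ i → Γ e₁ e₂ i γ → InΓ₀4 γ
  Γ⊆Γ₀4 γ zero                         = proj₁
  Γ⊆Γ₀4 γ (suc zero)                   = proj₁
  Γ⊆Γ₀4 γ (suc (suc zero))             = proj₁
  Γ⊆Γ₀4 γ (suc (suc (suc zero)))       = proj₁
  Γ⊆Γ₀4 γ (suc (suc (suc (suc zero)))) = proj₁

lemma5p4 : (e₁ e₂ : ℤ) →
    ((γ : Mat) → (InΓ₀4 γ → Σ (Fin 5) (λ i → Γ e₁ e₂ i γ)) × (Σ (Fin 5) (λ i → Γ e₁ e₂ i γ) → InΓ₀4 γ))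
    × ((γ : Mat) (i j : Fin 5) → Γ e₁ e₂ i γ → Γ e₁ e₂ j γ → i ≡ j)
lemma5p4 e₁ e₂ = (λ γ → Γ-cover e₁ e₂ γ , uncurry (Γ⊆Γ₀4 e₁ e₂ γ)) , Γ-index-unique e₁ e₂
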